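{- Every $\omega$-approximable total function $f:\omega\to\omega$ is bounded-Turing reducible to some total function approximable from above.
   Context: $f$ is $\omega$-approximable if $f(x)=\lim_s g(x,s)$ for some total computable $g$ and there is a total computable $h$ with $|\{s:g(x,s)\ne g(x,s+1)\}|\le h(x)$ for all $x$. A total function is approximable from above if it is $\lim_s g(x,s)$ for a total computable $g$ with $g(x,s+1)\le g(x,s)$ for all $x,s$. For total $\alpha,\beta:\omega\to\omega$, $\alpha\le_{bT}\beta$ if there are a Turing reduction $\Phi$ using $\beta$ as a function oracle (queried for values $\beta(y)$) and a total computable $b$ such that for each $x$, $\Phi$ computes $\alpha(x)$ querying only values $\beta(y)$ with $y<b(x)$. -}

module Defs where

open import Data.Nat using (ℕ; zero; suc; _≤_; _<_; _≟_)
open import Data.Fin using (Fin)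
open import Data.Vec using (Vec; []; _∷_; lookup)
open import Data.Product using (Σ; ∃; _×_; _,_)
open import Data.Empty using (⊥)
open import Relation.Nullary using (yes; no)
open import Relation.Binary.PropositionalEquality using (_≡_)

data Code : ℕ → Set where
  czero  : ∀ {n} → Code n
  csucc  : Code 1
  cproj  : ∀ {n} → Fin n → Code n
  ccomp  : ∀ {m n} → Code m → Vec (Code n) m → Code n
  cprec  : ∀ {n} → Code n → Code (suc (suc n)) → Code (suc n)  -- primitive recursion on first arg
  cmu    : ∀ {n} → Code (suc n) → Code n               -- unbounded minimisation on first arg
  corac  : Code 1

-- O is the oracle, Allowed says which oracle
-- arguments y may be queried; a query at y is only possible if Allowed y.
-- 'Eval O Allowed c xs v' : program c on input xs halts with output v,
-- querying the oracle only at allowed arguments.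
mutual
  data Eval (O : ℕ → ℕ) (Allowed : ℕ → Set) : ∀ {n} → Code n → Vec ℕ n → ℕ → Set where
    ezero : ∀ {n} {xs : Vec ℕ n} → Eval O Allowed czero xs 0
    esucc : ∀ {x} → Eval O Allowed csucc (x ∷ []) (suc x)
    eproj : ∀ {n} {i : Fin n} {xs} → Eval O Allowed (cproj i) xs (lookup xs i)
    ecomp : ∀ {m n} {f : Code m} {gs : Vec (Code n) m} {xs ys v} →
            EvalVec O Allowed gs xs ys → Eval O Allowed f ys v →
            Eval O Allowed (ccomp f gs) xs v
    eprec0 : ∀ {n} {f : Code n} {g} {xs v} →
             Eval O Allowed f xs v → Eval O Allowed (cprec f g) (0 ∷ xs) v
    eprecS : ∀ {n} {f : Code n} {g} {k xs r v} →
             Eval O Allowed (cprec f g) (k ∷ xs) r →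
             Eval O Allowed g (k ∷ r ∷ xs) v →
             Eval O Allowed (cprec f g) (suc k ∷ xs) v
    emu   : ∀ {n} {f : Code (suc n)} {xs y} →
            Eval O Allowed f (y ∷ xs) 0 →
            (∀ z → z < y → Σ ℕ λ w → Eval O Allowed f (z ∷ xs) (suc w)) →
            Eval O Allowed (cmu f) xs y
    eorac : ∀ {y} → Allowed y → Eval O Allowed corac (y ∷ []) (O y)

  data EvalVec (O : ℕ → ℕ) (Allowed : ℕ → Set) {n : ℕ} :
               ∀ {m} → Vec (Code n) m → Vec ℕ n → Vec ℕ m → Set where
    []  : ∀ {xs} → EvalVec O Allowed [] xs []
    _∷_ : ∀ {m} {g : Code n} {gs : Vec (Code n) m} {xs y ys} →
          Eval O Allowed g xs y → EvalVec O Allowed gs xs ys →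
          EvalVec O Allowed (g ∷ gs) xs (y ∷ ys)

NoOracle : ℕ → Set
NoOracle _ = ⊥

EvalC : ∀ {n} → Code n → Vec ℕ n → ℕ → Set
EvalC = Eval (λ _ → 0) NoOracle

Computable₁ : (ℕ → ℕ) → Set
Computable₁ f = Σ (Code 1) λ c → ∀ x → EvalC c (x ∷ []) (f x)

Computable₂ : (ℕ → ℕ → ℕ) → Set
Computable₂ g = Σ (Code 2) λ c → ∀ x s → EvalC c (x ∷ s ∷ []) (g x s)

IsLimit : (ℕ → ℕ → ℕ) → (ℕ → ℕ) → Set
IsLimit g f = ∀ x → Σ ℕ λ s₀ → ∀ s → s₀ ≤ s → g x s ≡ f x

changes : (ℕ → ℕ → ℕ) → ℕ → ℕ → ℕ
changes g x zero = 0
changes g x (suc n) with g x n ≟ g x (suc n)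
... | yes _ = changes g x n
... | no  _ = suc (changes g x n)

-- |{ s : g x s ≢ g x (s+1) }| ≤ h x   (every finite initial segment has ≤ h x changes)
ChangesBoundedBy : (ℕ → ℕ → ℕ) → (ℕ → ℕ) → Set
ChangesBoundedBy g h = ∀ x n → changes g x n ≤ h x

OmegaApproximable : (ℕ → ℕ) → Set
OmegaApproximable f =
  Σ (ℕ → ℕ → ℕ) λ g → Σ (ℕ → ℕ) λ h →
    Computable₂ g × IsLimit g f × Computable₁ h × ChangesBoundedBy g h

ApproximableFromAbove : (ℕ → ℕ) → Set
ApproximableFromAbove f =
  Σ (ℕ → ℕ → ℕ) λ g →
    Computable₂ g × (∀ x s → g x (suc s) ≤ g x s) × IsLimit g f

_≤bT_ : (ℕ → ℕ) → (ℕ → ℕ) → Set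
α ≤bT β =
  Σ (Code 1) λ Φ → Σ (ℕ → ℕ) λ b →
    Computable₁ b × (∀ x → Eval β (λ y → y < b x) Φ (x ∷ []) (α x))

-- The final number of mind changes N x of the ω-approximation g is bounded by h x, so
-- β x = h x ∸ N x is approximated from above by h x ∸ (mind changes of g x up to stage s).
-- Conversely, one query of β at x recovers N x = h x ∸ β x, and f x = g x s for the
-- least s by which g x has made N x mind changes, as g x never changes after that stage.
module Submission where

open import Defs
open import Data.Nat using (ℕ; zero; suc; _+_; _∸_; pred; _≤_; _<_; _≟_; ∣_-_∣; z≤n; ≢-nonZero)
open import Data.Nat.Properties
open import Data.Fin using (#_)
open import Data.Vec using (Vec; []; _∷_)
open import Data.Product using (Σ; _×_; _,_; proj₁; proj₂)
open import Data.Sum using (_⊎_; inj₁; inj₂)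
open import Relation.Nullary using (yes; no; contradiction)
open import Relation.Binary.PropositionalEquality

mutual
  relativise : ∀ {O O′ A n} {c : Code n} {xs v} →
               Eval O′ NoOracle c xs v → Eval O A c xs v
  relativise ezero          = ezero
  relativise esucc          = esucc
  relativise eproj          = eproj
  relativise (ecomp es e)   = ecomp (relativiseVec es) (relativise e)
  relativise (eprec0 e)     = eprec0 (relativise e)
  relativise (eprecS e e′)  = eprecS (relativise e) (relativise e′)
  relativise (emu e nz)     = emu (relativise e) λ z z<y → proj₁ (nz z z<y) , relativise (proj₂ (nz z z<y))
  relativise (eorac ())

  relativiseVec : ∀ {O O′ A n m} {gs : Vec (Code n) m} {xs ys} →
                  EvalVec O′ NoOracle gs xs ys → EvalVec O A gs xs ys
  relativiseVec []       = []
  relativiseVec (e ∷ es) = relativise e ∷ relativiseVec es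

sg : ℕ → ℕ
sg zero    = 0
sg (suc _) = 1

m∸n+n∸m≡∣m-n∣ : ∀ m n → (m ∸ n) + (n ∸ m) ≡ ∣ m - n ∣
m∸n+n∸m≡∣m-n∣ zero    zero    = refl
m∸n+n∸m≡∣m-n∣ zero    (suc n) = refl
m∸n+n∸m≡∣m-n∣ (suc m) zero    = +-identityʳ (suc m)
m∸n+n∸m≡∣m-n∣ (suc m) (suc n) = m∸n+n∸m≡∣m-n∣ m n

predCode : Code 1
predCode = cprec czero (cproj (# 0))

-- Primitive recursion runs on the first argument, so monusCode maps (b , a) to a ∸ b.
monusCode : Code 2
monusCode = cprec (cproj (# 0)) (ccomp predCode (cproj (# 1) ∷ []))

addCode : Code 2
addCode = cprec (cproj (# 0)) (ccomp csucc (cproj (# 1) ∷ []))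

sgCode : Code 1
sgCode = cprec czero (ccomp csucc (czero ∷ []))

distCode : Code 2
distCode = ccomp addCode (ccomp monusCode (cproj (# 1) ∷ cproj (# 0) ∷ [])
                        ∷ ccomp monusCode (cproj (# 0) ∷ cproj (# 1) ∷ []) ∷ [])

IsLeastZero : (ℕ → ℕ) → ℕ → Set
IsLeastZero F y = F y ≡ 0 × (∀ z → z < y → F z ≢ 0)

leastZero-below : ∀ (F : ℕ → ℕ) n → (Σ ℕ (IsLeastZero F)) ⊎ (∀ z → z < n → F z ≢ 0)
leastZero-below F zero = inj₂ λ _ ()
leastZero-below F (suc n) with leastZero-below F n
... | inj₁ found = inj₁ found
... | inj₂ none with F n ≟ 0
...   | yes Fn≡0 = inj₁ (n , Fn≡0 , none)
...   | no  Fn≢0 = inj₂ λ z z<1+n → nonzero z (m<1+n⇒m<n∨m≡n z<1+n)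
  where
  nonzero : ∀ z → z < n ⊎ z ≡ n → F z ≢ 0
  nonzero z (inj₁ z<n)  = none z z<n
  nonzero z (inj₂ refl) = Fn≢0

leastZero : ∀ (F : ℕ → ℕ) {z₀} → F z₀ ≡ 0 → Σ ℕ (IsLeastZero F)
leastZero F {z₀} Fz₀≡0 with leastZero-below F (suc z₀)
... | inj₁ found = found
... | inj₂ none  = contradiction Fz₀≡0 (none z₀ ≤-refl)

module _ {O : ℕ → ℕ} {A : ℕ → Set} where

  eval-pred : ∀ n → Eval O A predCode (n ∷ []) (pred n)
  eval-pred zero    = eprec0 ezero
  eval-pred (suc n) = eprecS (eval-pred n) eproj

  eval-monus : ∀ b a → Eval O A monusCode (b ∷ a ∷ []) (a ∸ b)
  eval-monus zero    a = eprec0 eproj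
  eval-monus (suc b) a = subst (Eval O A monusCode (suc b ∷ a ∷ [])) (pred[m∸n]≡m∸[1+n] a b)
    (eprecS (eval-monus b a) (ecomp (eproj ∷ []) (eval-pred (a ∸ b))))

  eval-add : ∀ a b → Eval O A addCode (a ∷ b ∷ []) (a + b)
  eval-add zero    b = eprec0 eproj
  eval-add (suc a) b = eprecS (eval-add a b) (ecomp (eproj ∷ []) esucc)

  eval-sg : ∀ n → Eval O A sgCode (n ∷ []) (sg n)
  eval-sg zero    = eprec0 ezero
  eval-sg (suc n) = eprecS (eval-sg n) (ecomp (ezero ∷ []) esucc)

  eval-dist : ∀ a b → Eval O A distCode (a ∷ b ∷ []) ∣ a - b ∣
  eval-dist a b = subst (Eval O A distCode (a ∷ b ∷ [])) (m∸n+n∸m≡∣m-n∣ a b)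
    (ecomp (ecomp (eproj ∷ eproj ∷ []) (eval-monus b a)
          ∷ ecomp (eproj ∷ eproj ∷ []) (eval-monus a b) ∷ []) (eval-add _ _))

  eval-μ : ∀ {n} {c : Code (suc n)} {xs} (F : ℕ → ℕ) →
           (∀ z → Eval O A c (z ∷ xs) (F z)) →
           ∀ {z₀} → F z₀ ≡ 0 → Σ ℕ λ y → F y ≡ 0 × Eval O A (cmu c) xs y
  eval-μ {c = c} {xs} F evalF Fz₀≡0 with leastZero F Fz₀≡0
  ... | y , Fy≡0 , below = y , Fy≡0 , emu (subst (Eval O A c (y ∷ xs)) Fy≡0 (evalF y)) positive
    where
    positive : ∀ z → z < y → Σ ℕ λ w → Eval O A c (z ∷ xs) (suc w)
    positive z z<y = pred (F z) , subst (Eval O A c (z ∷ xs))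
      (sym (suc-pred (F z) {{≢-nonZero (below z z<y)}})) (evalF z)

module _ (g : ℕ → ℕ → ℕ) (x : ℕ) where

  changes-suc : ∀ n → changes g x (suc n) ≡ changes g x n + sg ∣ g x n - g x (suc n) ∣
  changes-suc n with g x n ≟ g x (suc n)
  ... | yes same = sym (trans (cong (λ d → changes g x n + sg d) (m≡n⇒∣m-n∣≡0 same)) (+-identityʳ _))
  ... | no  diff with ∣ g x n - g x (suc n) ∣ in dist
  ...   | zero  = contradiction (∣m-n∣≡0⇒m≡n dist) diff
  ...   | suc _ = +-comm 1 (changes g x n)

  changes-≤-suc : ∀ n → changes g x n ≤ changes g x (suc n)
  changes-≤-suc n = subst (changes g x n ≤_) (sym (changes-suc n)) (m≤m+n _ _)

  changes-mono : ∀ {m n} → m ≤ n → changes g x m ≤ changes g x n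
  changes-mono {n = zero}  z≤n = ≤-refl
  changes-mono {n = suc n} m≤1+n with m≤n⇒m<n∨m≡n m≤1+n
  ... | inj₁ m<1+n = ≤-trans (changes-mono (m<1+n⇒m≤n m<1+n)) (changes-≤-suc n)
  ... | inj₂ refl = ≤-refl

  g≡⇒changes-suc≡ : ∀ n → g x n ≡ g x (suc n) → changes g x (suc n) ≡ changes g x n
  g≡⇒changes-suc≡ n same with g x n ≟ g x (suc n)
  ... | yes _    = refl
  ... | no  diff = contradiction same diff

  changes-suc≡⇒g≡ : ∀ n → changes g x (suc n) ≡ changes g x n → g x n ≡ g x (suc n)
  changes-suc≡⇒g≡ n eq with g x n ≟ g x (suc n)
  ... | yes same = same
  ... | no  _    = contradiction eq 1+n≢n

  changes-≡⇒≡ : ∀ {m n} → m ≤ n → changes g x m ≡ changes g x n → g x m ≡ g x n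
  changes-≡⇒≡ {n = zero}  z≤n _ = refl
  changes-≡⇒≡ {m} {suc n} m≤1+n eq with m≤n⇒m<n∨m≡n m≤1+n
  ... | inj₂ refl = refl
  ... | inj₁ m<1+n = trans (changes-≡⇒≡ m≤n (≤-antisym (changes-mono m≤n) cₙ≤cₘ))
                           (changes-suc≡⇒g≡ n (≤-antisym (subst (_≤ changes g x n) eq (changes-mono m≤n))
                                                          (changes-≤-suc n)))
    where
    m≤n : m ≤ n
    m≤n = m<1+n⇒m≤n m<1+n
    cₙ≤cₘ : changes g x n ≤ changes g x m
    cₙ≤cₘ = subst (changes g x n ≤_) (sym eq) (changes-≤-suc n)

  changes-stabilises : ∀ {s₀ v} → (∀ s → s₀ ≤ s → g x s ≡ v) →
                       ∀ {s} → s₀ ≤ s → changes g x s ≡ changes g x s₀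
  changes-stabilises stable {zero} z≤n = refl
  changes-stabilises {s₀} stable {suc s} s₀≤1+s with m≤n⇒m<n∨m≡n s₀≤1+s
  ... | inj₂ refl = refl
  ... | inj₁ s₀<1+s = trans (g≡⇒changes-suc≡ s (trans (stable s s₀≤s) (sym (stable (suc s) s₀≤1+s))))
                            (changes-stabilises stable s₀≤s)
    where
    s₀≤s : s₀ ≤ s
    s₀≤s = m<1+n⇒m≤n s₀<1+s

changesCode : Code 2 → Code 2
changesCode G = cprec czero
  (ccomp addCode (cproj (# 1)
                 ∷ ccomp sgCode (ccomp distCode (ccomp G (cproj (# 2) ∷ cproj (# 0) ∷ [])
                                               ∷ ccomp G (cproj (# 2) ∷ ccomp csucc (cproj (# 0) ∷ []) ∷ [])
                                               ∷ []) ∷ [])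
                 ∷ []))

eval-changes : ∀ {O A g G} → (∀ x s → EvalC G (x ∷ s ∷ []) (g x s)) →
               ∀ n x → Eval O A (changesCode G) (n ∷ x ∷ []) (changes g x n)
eval-changes evalG zero    x = eprec0 ezero
eval-changes {O} {A} {g} {G} evalG (suc n) x =
  subst (Eval O A (changesCode G) (suc n ∷ x ∷ [])) (sym (changes-suc g x n))
    (eprecS (eval-changes evalG n x)
      (ecomp (eproj ∷ ecomp (ecomp (ecomp (eproj ∷ eproj ∷ []) (relativise (evalG x n))
                                   ∷ ecomp (eproj ∷ ecomp (eproj ∷ []) esucc ∷ []) (relativise (evalG x (suc n)))
                                   ∷ []) (eval-dist _ _) ∷ []) (eval-sg _) ∷ [])
             (eval-add _ _)))

module FromOmegaApproximation
  (f : ℕ → ℕ) (g : ℕ → ℕ → ℕ) (h : ℕ → ℕ) (G : Code 2) (H : Code 1)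
  (evalG : ∀ x s → EvalC G (x ∷ s ∷ []) (g x s)) (evalH : ∀ x → EvalC H (x ∷ []) (h x))
  (limit : IsLimit g f) (bounded : ChangesBoundedBy g h) where

  settlingStage : ℕ → ℕ
  settlingStage x = proj₁ (limit x)

  totalChanges : ℕ → ℕ
  totalChanges x = changes g x (settlingStage x)

  changes-settled : ∀ x {s} → settlingStage x ≤ s → changes g x s ≡ totalChanges x
  changes-settled x = changes-stabilises g x (proj₂ (limit x))

  β : ℕ → ℕ
  β x = h x ∸ totalChanges x

  h∸β≡totalChanges : ∀ x → h x ∸ β x ≡ totalChanges x
  h∸β≡totalChanges x = m∸[m∸n]≡n (bounded x (settlingStage x))

  β-approximableFromAbove : ApproximableFromAbove β
  β-approximableFromAbove =
    (λ x s → h x ∸ changes g x s) ,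
    (ccomp monusCode (ccomp (changesCode G) (cproj (# 1) ∷ cproj (# 0) ∷ [])
                     ∷ ccomp H (cproj (# 0) ∷ []) ∷ []) ,
     λ x s → ecomp (ecomp (eproj ∷ eproj ∷ []) (eval-changes evalG s x)
                   ∷ ecomp (eproj ∷ []) (evalH x) ∷ [])
                   (eval-monus _ _)) ,
    (λ x s → ∸-monoʳ-≤ (h x) (changes-≤-suc g x s)) ,
    (λ x → settlingStage x , λ s settled → cong (h x ∸_) (changes-settled x settled))

  g≡f-onceSettled : ∀ x s → changes g x s ≡ totalChanges x → g x s ≡ f x
  g≡f-onceSettled x s settled =
    trans (changes-≡⇒≡ g x (m≤m+n s t) (trans settled (sym (changes-settled x (m≤n+m t s)))))
          (proj₂ (limit x) (s + t) (m≤n+m t s))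
    where t = settlingStage x

  unsettledCode : Code 2
  unsettledCode = ccomp distCode
    (changesCode G ∷ ccomp monusCode (ccomp corac (cproj (# 1) ∷ []) ∷ ccomp H (cproj (# 1) ∷ []) ∷ []) ∷ [])

  eval-unsettled : ∀ s x → Eval β (_< suc x) unsettledCode (s ∷ x ∷ []) ∣ changes g x s - totalChanges x ∣
  eval-unsettled s x = subst (λ N → Eval β (_< suc x) unsettledCode (s ∷ x ∷ []) ∣ changes g x s - N ∣)
    (h∸β≡totalChanges x)
    (ecomp (eval-changes evalG s x
           ∷ ecomp (ecomp (eproj ∷ []) (eorac ≤-refl) ∷ ecomp (eproj ∷ []) (relativise (evalH x)) ∷ [])
                   (eval-monus _ _) ∷ [])
           (eval-dist _ _))

  reductionCode : Code 1
  reductionCode = ccomp G (cproj (# 0) ∷ cmu unsettledCode ∷ [])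

  eval-reduction : ∀ x → Eval β (_< suc x) reductionCode (x ∷ []) (f x)
  eval-reduction x with eval-μ (λ s → ∣ changes g x s - totalChanges x ∣) (λ s → eval-unsettled s x)
                              {settlingStage x} (m≡n⇒∣m-n∣≡0 (changes-settled x ≤-refl))
  ... | s , unsettled≡0 , evalμ =
    subst (Eval β (_< suc x) reductionCode (x ∷ [])) (g≡f-onceSettled x s (∣m-n∣≡0⇒m≡n unsettled≡0))
      (ecomp (eproj ∷ evalμ ∷ []) (relativise (evalG x s)))

theorem3p8 : (f : ℕ → ℕ) → OmegaApproximable f →
    Σ (ℕ → ℕ) λ β → ApproximableFromAbove β × (f ≤bT β)
theorem3p8 f (g , h , (G , evalG) , limit , (H , evalH) , bounded) =
  β , β-approximableFromAbove , reductionCode , suc , (csucc , λ _ → esucc) , eval-reduction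
  where open FromOmegaApproximation f g h G H evalG evalH limit bounded
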